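{- If a permutation $\pi$ is achievable, then it can be produced by a canonical operation sequence.
   Context: Two parallel stacks: input items $1,\dots,n$ arrive in order. An operation sequence is a word over $\{I_1,I_2,O_1,O_2\}$ ($I_i$ pushes the next input item onto stack $i$, $O_i$ pops stack $i$ to the output) with as many $I_i$ as $O_i$ for $i=1,2$ and every prefix having at least as many $I_i$ as $O_i$. It produces the output-order permutation; a permutation is achievable if some operation sequence produces it. It outputs eagerly if it contains neither $I_1O_2$ nor $I_2O_1$ as a factor. Its arch system: points $1,\dots,2n$ on a line, and for each item an arch joining its input and output times, red (above the line) for stack 1, blue (below) for stack 2. Arches of different colours cross if their endpoints interleave; components are connected components of the graph on arches with crossing pairs as edges. Standard: the arch with smallest left endpoint in each component is red. Canonical: standard and outputs eagerly. -}

module Defs where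

open import Data.Nat using (ℕ; zero; suc; _+_; _≤_; _<_)
open import Data.List using (List; []; _∷_; _++_; reverse)
open import Data.List.Membership.Propositional using (_∈_)
open import Data.Product using (_×_; _,_; ∃; ∃-syntax; proj₁; proj₂)
open import Data.Sum using (_⊎_)
open import Relation.Binary.PropositionalEquality using (_≡_; _≢_)
open import Relation.Nullary using (¬_)

-- Operations: Iᵢ pushes the next input item onto stack i, Oᵢ pops stack i.
data Op : Set where
  I₁ I₂ O₁ O₂ : Op

count : Op → List Op → ℕ
count o [] = 0
count I₁ (I₁ ∷ w) = suc (count I₁ w)
count I₂ (I₂ ∷ w) = suc (count I₂ w)
count O₁ (O₁ ∷ w) = suc (count O₁ w)
count O₂ (O₂ ∷ w) = suc (count O₂ w)
count o (_ ∷ w) = count o w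

record OpSeq (n : ℕ) (w : List Op) : Set where
  field
    balanced₁ : count I₁ w ≡ count O₁ w
    balanced₂ : count I₂ w ≡ count O₂ w
    items     : count I₁ w + count I₂ w ≡ n
    prefix₁   : ∀ u v → w ≡ u ++ v → count O₁ u ≤ count I₁ u
    prefix₂   : ∀ u v → w ≡ u ++ v → count O₂ u ≤ count I₂ u

data Colour : Set where
  red blue : Colour

-- An arch: colour, left endpoint (input time), right endpoint (output time).
record Arch : Set where
  constructor arch
  field
    colour : Colour
    left   : ℕ
    right  : ℕ
open Arch public

-- State: current time t (1-based position of the next operation),
-- next input item k, stack 1 and stack 2 (entries: item, input time),
-- output so far (reversed), arches so far.
-- Popping an empty stack cannot occur for operation sequences (prefix condition);
-- it is treated as a no-op.
record State : Set where
  constructor st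
  field
    time   : ℕ
    next   : ℕ
    stack₁ : List (ℕ × ℕ)
    stack₂ : List (ℕ × ℕ)
    outRev : List ℕ
    arches : List Arch

step : State → Op → State
step (st t k s₁ s₂ o a) I₁ = st (suc t) (suc k) ((k , t) ∷ s₁) s₂ o a
step (st t k s₁ s₂ o a) I₂ = st (suc t) (suc k) s₁ ((k , t) ∷ s₂) o a
step (st t k [] s₂ o a) O₁ = st (suc t) k [] s₂ o a
step (st t k ((x , tᵢ) ∷ s₁) s₂ o a) O₁ =
  st (suc t) k s₁ s₂ (x ∷ o) (arch red tᵢ t ∷ a)
step (st t k s₁ [] o a) O₂ = st (suc t) k s₁ [] o a
step (st t k s₁ ((x , tᵢ) ∷ s₂) o a) O₂ =
  st (suc t) k s₁ s₂ (x ∷ o) (arch blue tᵢ t ∷ a)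

run : State → List Op → State
run s [] = s
run s (o ∷ w) = run (step s o) w

-- Items are 1,…,n, time points are 1,…,2n.
final : List Op → State
final w = run (st 1 1 [] [] [] []) w

output : List Op → List ℕ
output w = reverse (State.outRev (final w))

archSystem : List Op → List Arch
archSystem w = State.arches (final w)

-- π (a permutation of 1..n in one-line notation) is achievable.
Achievable : (n : ℕ) → List ℕ → Set
Achievable n π = ∃[ w ] (OpSeq n w × output w ≡ π)

OutputsEagerly : List Op → Set
OutputsEagerly w =
  (∀ u v → w ≢ u ++ I₁ ∷ O₂ ∷ v) × (∀ u v → w ≢ u ++ I₂ ∷ O₁ ∷ v)

Interleave : Arch → Arch → Set
Interleave a b = (left a < left b × left b < right a × right a < right b)
               ⊎ (left b < left a × left a < right b × right b < right a)

Cross : Arch → Arch → Set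
Cross a b = colour a ≢ colour b × Interleave a b

data Connected (As : List Arch) : Arch → Arch → Set where
  here : ∀ {a} → Connected As a a
  link : ∀ {a b c} → b ∈ As → Cross a b → Connected As b c → Connected As a c

Standard : List Op → Set
Standard w =
  ∀ a → a ∈ archSystem w →
  (∀ b → b ∈ archSystem w → Connected (archSystem w) a b → left a ≤ left b) →
  colour a ≡ red

Canonical : List Op → Set
Canonical w = Standard w × OutputsEagerly w

-- Eagerness: a push immediately followed by a pop of the other stack can be moved behind
-- that pop without changing the output, and each such swap removes one (push, later pop)
-- pair, so repeated swapping reaches an eager sequence.
--
-- Standardness: if the leftmost arch of some component is blue, recolour the whole
-- component. When an item is popped, every item above it in the merged order of the two
-- stacks lies on the other stack and was pushed later but is popped later, so its arch
-- crosses that of the popped item and is recoloured with it. Hence the recoloured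
-- sequence is still an operation sequence with the same output; it is still eager, and
-- its first changed letter turns an I₂ into an I₁ (at the left end of the leftmost arch),
-- so the word decreases lexicographically and the recolouring terminates.

module Submission where

open import Defs
open import Data.Bool using (Bool; true; false; if_then_else_)
open import Data.Bool.Properties using (⇔→≡)
open import Data.Empty using (⊥-elim)
open import Data.List using (List; []; _∷_; _++_; [_]; length; map; reverse; foldl; filter)
open import Data.List.Properties using (++-assoc; ++-identityʳ; filter-notAll; ∷-injectiveˡ; ∷-injectiveʳ; length-++; length-map; map-++)
open import Data.List.Membership.Propositional using (_∈_; lose; find)
open import Data.List.Membership.Propositional.Properties using (∈-++⁺ˡ; ∈-++⁺ʳ; ∈-++⁻; ∈-map⁺; ∈-filter⁺; ∈-filter⁻)
open import Data.List.Relation.Binary.Subset.Propositional using (_⊆_)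
open import Data.List.Relation.Binary.Permutation.Propositional using (_↭_; ↭-refl; ↭-sym; ↭-trans; ↭-swap; ↭⇒↭ₛ)
open import Data.List.Relation.Binary.Permutation.Propositional.Properties using (++⁺ˡ; map⁺; shift; All-resp-↭)
open import Data.List.Relation.Unary.All as All using (All; []; _∷_)
import Data.List.Relation.Unary.All.Properties as All
open import Data.List.Relation.Unary.AllPairs using ([]; _∷_)
open import Data.List.Relation.Unary.Any as Any using (Any; here; there; any?)
open import Data.List.Relation.Unary.Unique.Propositional using (Unique)
open import Data.Nat using (ℕ; suc; _+_; _*_; _^_; _≤_; _<_; _≤?_; _<?_; _≟_; z≤n; s≤s)
open import Data.Nat.Induction using (<-wellFounded)
open import Data.Nat.ListAction using (sum)
open import Data.Nat.ListAction.Properties using (sum-↭)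
open import Data.Nat.Properties
open import Data.Product using (∃-syntax; _×_; _,_; proj₁; proj₂)
open import Data.Sum using (_⊎_; inj₁; inj₂; [_,_]′)
open import Data.Unit using (⊤; tt)
open import Function using (_∘_; id)
open import Function.Bundles using (mk⇔)
open import Induction.WellFounded using (Acc; acc)
open import Relation.Binary.PropositionalEquality hiding ([_])
open import Relation.Nullary using (¬_; Dec; yes; no; ¬?; does; contradiction)
open import Relation.Nullary.Decidable using (_×-dec_; _⊎-dec_; dec-true)
open import Data.List.Relation.Binary.Permutation.Setoid.Properties (setoid ℕ) using (Unique-resp-↭)

opposite : Colour → Colour
opposite red = blue
opposite blue = red

push pop : Colour → Op
push red = I₁
push blue = I₂
pop red = O₁
pop blue = O₂

-- Operation sequences as runs of the untimed machine

record Config : Set where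
  constructor cfg
  field
    next   : ℕ
    stack₁ : List ℕ
    stack₂ : List ℕ
    outRev : List ℕ

configOf : State → Config
configOf (st t k s₁ s₂ o a) = cfg k (map proj₁ s₁) (map proj₁ s₂) o

stepC : Config → Op → Config
stepC (cfg k s₁ s₂ o) I₁ = cfg (suc k) (k ∷ s₁) s₂ o
stepC (cfg k s₁ s₂ o) I₂ = cfg (suc k) s₁ (k ∷ s₂) o
stepC (cfg k [] s₂ o) O₁ = cfg k [] s₂ o
stepC (cfg k (x ∷ s₁) s₂ o) O₁ = cfg k s₁ s₂ (x ∷ o)
stepC (cfg k s₁ [] o) O₂ = cfg k s₁ [] o
stepC (cfg k s₁ (x ∷ s₂) o) O₂ = cfg k s₁ s₂ (x ∷ o)

runC : Config → List Op → Config
runC = foldl stepC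

initial : State
initial = st 1 1 [] [] [] []

initialC : Config
initialC = cfg 1 [] [] []

stackC : Colour → Config → List ℕ
stackC red = Config.stack₁
stackC blue = Config.stack₂

configOf-step : ∀ s o → configOf (step s o) ≡ stepC (configOf s) o
configOf-step (st t k s₁ s₂ o a) I₁ = refl
configOf-step (st t k s₁ s₂ o a) I₂ = refl
configOf-step (st t k [] s₂ o a) O₁ = refl
configOf-step (st t k (_ ∷ s₁) s₂ o a) O₁ = refl
configOf-step (st t k s₁ [] o a) O₂ = refl
configOf-step (st t k s₁ (_ ∷ s₂) o a) O₂ = refl

configOf-run : ∀ s w → configOf (run s w) ≡ runC (configOf s) w
configOf-run s [] = refl
configOf-run s (o ∷ w) = trans (configOf-run (step s o) w) (cong (λ c → runC c w) (configOf-step s o))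

output-runC : ∀ w → output w ≡ reverse (Config.outRev (runC initialC w))
output-runC w = cong (reverse ∘ Config.outRev) (configOf-run initial w)

Enabled : Config → Op → Set
Enabled c O₁ = Config.stack₁ c ≢ []
Enabled c O₂ = Config.stack₂ c ≢ []
Enabled c _ = ⊤

Feasible : Config → List Op → Set
Feasible c [] = ⊤
Feasible c (o ∷ w) = Enabled c o × Feasible (stepC c o) w

Drained : Config → Set
Drained c = Config.stack₁ c ≡ [] × Config.stack₂ c ≡ []

data Kind : Op → Set where
  pushing : ∀ c → Kind (push c)
  popping : ∀ c → Kind (pop c)

kind : ∀ o → Kind o
kind I₁ = pushing red
kind I₂ = pushing blue
kind O₁ = popping red
kind O₂ = popping blue

pushBit popBit : Op → ℕ
pushBit I₁ = 1
pushBit I₂ = 1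
pushBit _ = 0
popBit O₁ = 1
popBit O₂ = 1
popBit _ = 0

pushBit-push : ∀ c → pushBit (push c) ≡ 1
pushBit-push red = refl
pushBit-push blue = refl

pushBit-pop : ∀ c → pushBit (pop c) ≡ 0
pushBit-pop red = refl
pushBit-pop blue = refl

pushes pops : List Op → ℕ
pushes = sum ∘ map pushBit
pops = sum ∘ map popBit

Admissible : ℕ → List Op → Set
Admissible n w = Feasible initialC w × Drained (runC initialC w) × pushes w ≡ n

PrefixBounded : Colour → ℕ → List Op → Set
PrefixBounded col d w = ∀ u v → w ≡ u ++ v → count (pop col) u ≤ d + count (push col) u

stack-balance : ∀ col c w → Feasible c w →
  length (stackC col (runC c w)) + count (pop col) w ≡ length (stackC col c) + count (push col) w
stack-balance col c [] _ = refl
stack-balance red (cfg k s₁ s₂ o) (I₁ ∷ w) (_ , f) = trans (stack-balance red _ w f) (sym (+-suc _ _))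
stack-balance blue (cfg k s₁ s₂ o) (I₁ ∷ w) (_ , f) = stack-balance blue _ w f
stack-balance red (cfg k s₁ s₂ o) (I₂ ∷ w) (_ , f) = stack-balance red _ w f
stack-balance blue (cfg k s₁ s₂ o) (I₂ ∷ w) (_ , f) = trans (stack-balance blue _ w f) (sym (+-suc _ _))
stack-balance col (cfg k [] s₂ o) (O₁ ∷ w) (e , _) = ⊥-elim (e refl)
stack-balance red (cfg k (_ ∷ s₁) s₂ o) (O₁ ∷ w) (_ , f) = trans (+-suc _ _) (cong suc (stack-balance red _ w f))
stack-balance blue (cfg k (_ ∷ s₁) s₂ o) (O₁ ∷ w) (_ , f) = stack-balance blue _ w f
stack-balance col (cfg k s₁ [] o) (O₂ ∷ w) (e , _) = ⊥-elim (e refl)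
stack-balance red (cfg k s₁ (_ ∷ s₂) o) (O₂ ∷ w) (_ , f) = stack-balance red _ w f
stack-balance blue (cfg k s₁ (_ ∷ s₂) o) (O₂ ∷ w) (_ , f) = trans (+-suc _ _) (cong suc (stack-balance blue _ w f))

feasible⇒prefixBounded : ∀ col c w → Feasible c w → PrefixBounded col (length (stackC col c)) w
feasible⇒prefixBounded col c w f [] v eq = z≤n
feasible⇒prefixBounded red (cfg k s₁ s₂ o) (I₁ ∷ w) (_ , f) (I₁ ∷ u) v refl =
  ≤-trans (feasible⇒prefixBounded red _ w f u v refl) (≤-reflexive (sym (+-suc _ _)))
feasible⇒prefixBounded blue (cfg k s₁ s₂ o) (I₁ ∷ w) (_ , f) (I₁ ∷ u) v refl =
  feasible⇒prefixBounded blue _ w f u v refl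
feasible⇒prefixBounded red (cfg k s₁ s₂ o) (I₂ ∷ w) (_ , f) (I₂ ∷ u) v refl =
  feasible⇒prefixBounded red _ w f u v refl
feasible⇒prefixBounded blue (cfg k s₁ s₂ o) (I₂ ∷ w) (_ , f) (I₂ ∷ u) v refl =
  ≤-trans (feasible⇒prefixBounded blue _ w f u v refl) (≤-reflexive (sym (+-suc _ _)))
feasible⇒prefixBounded col (cfg k [] s₂ o) (O₁ ∷ w) (e , _) (O₁ ∷ u) v refl = ⊥-elim (e refl)
feasible⇒prefixBounded red (cfg k (_ ∷ s₁) s₂ o) (O₁ ∷ w) (_ , f) (O₁ ∷ u) v refl =
  s≤s (feasible⇒prefixBounded red _ w f u v refl)
feasible⇒prefixBounded blue (cfg k (_ ∷ s₁) s₂ o) (O₁ ∷ w) (_ , f) (O₁ ∷ u) v refl =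
  feasible⇒prefixBounded blue _ w f u v refl
feasible⇒prefixBounded col (cfg k s₁ [] o) (O₂ ∷ w) (e , _) (O₂ ∷ u) v refl = ⊥-elim (e refl)
feasible⇒prefixBounded red (cfg k s₁ (_ ∷ s₂) o) (O₂ ∷ w) (_ , f) (O₂ ∷ u) v refl =
  feasible⇒prefixBounded red _ w f u v refl
feasible⇒prefixBounded blue (cfg k s₁ (_ ∷ s₂) o) (O₂ ∷ w) (_ , f) (O₂ ∷ u) v refl =
  s≤s (feasible⇒prefixBounded blue _ w f u v refl)

tail-bounded : ∀ {col d d′} o {w} →
  (∀ u → count (pop col) (o ∷ u) ≤ d + count (push col) (o ∷ u) → count (pop col) u ≤ d′ + count (push col) u) →
  PrefixBounded col d (o ∷ w) → PrefixBounded col d′ w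
tail-bounded o shift p u v eq = shift u (p (o ∷ u) v (cong (o ∷_) eq))

prefixBounded⇒feasible : ∀ c w → PrefixBounded red (length (Config.stack₁ c)) w →
  PrefixBounded blue (length (Config.stack₂ c)) w → Feasible c w
prefixBounded⇒feasible c [] _ _ = tt
prefixBounded⇒feasible (cfg k s₁ s₂ o) (I₁ ∷ w) p q =
  tt , prefixBounded⇒feasible _ w (tail-bounded I₁ (λ _ h → ≤-trans h (≤-reflexive (+-suc _ _))) p)
                                  (tail-bounded I₁ (λ _ h → h) q)
prefixBounded⇒feasible (cfg k s₁ s₂ o) (I₂ ∷ w) p q =
  tt , prefixBounded⇒feasible _ w (tail-bounded I₂ (λ _ h → h) p)
                                  (tail-bounded I₂ (λ _ h → ≤-trans h (≤-reflexive (+-suc _ _))) q)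
prefixBounded⇒feasible (cfg k [] s₂ o) (O₁ ∷ w) p q with p (O₁ ∷ []) w refl
... | ()
prefixBounded⇒feasible (cfg k (_ ∷ s₁) s₂ o) (O₁ ∷ w) p q =
  (λ ()) , prefixBounded⇒feasible _ w (tail-bounded O₁ (λ _ → ≤-pred) p) (tail-bounded O₁ (λ _ h → h) q)
prefixBounded⇒feasible (cfg k s₁ [] o) (O₂ ∷ w) p q with q (O₂ ∷ []) w refl
... | ()
prefixBounded⇒feasible (cfg k s₁ (_ ∷ s₂) o) (O₂ ∷ w) p q =
  (λ ()) , prefixBounded⇒feasible _ w (tail-bounded O₂ (λ _ h → h) p) (tail-bounded O₂ (λ _ → ≤-pred) q)

pushes-count : ∀ w → count I₁ w + count I₂ w ≡ pushes w
pushes-count [] = refl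
pushes-count (I₁ ∷ w) = cong suc (pushes-count w)
pushes-count (I₂ ∷ w) = trans (+-suc (count I₁ w) _) (cong suc (pushes-count w))
pushes-count (O₁ ∷ w) = pushes-count w
pushes-count (O₂ ∷ w) = pushes-count w

stackC-initialC : ∀ col → stackC col initialC ≡ []
stackC-initialC red = refl
stackC-initialC blue = refl

length≡0⇒≡[] : ∀ {A : Set} {xs : List A} → length xs ≡ 0 → xs ≡ []
length≡0⇒≡[] {xs = []} _ = refl
length≡0⇒≡[] {xs = _ ∷ _} ()

opSeq⇒admissible : ∀ {n w} → OpSeq n w → Admissible n w
opSeq⇒admissible {w = w} os = feasible , (drained red balanced₁ , drained blue balanced₂) , trans (sym (pushes-count w)) items
  where
  open OpSeq os
  feasible : Feasible initialC w
  feasible = prefixBounded⇒feasible initialC w prefix₁ prefix₂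
  drained : ∀ col → count (push col) w ≡ count (pop col) w → stackC col (runC initialC w) ≡ []
  drained col bal = length≡0⇒≡[] (+-cancelʳ-≡ (count (pop col) w) _ 0 (begin
    length (stackC col (runC initialC w)) + count (pop col) w  ≡⟨ stack-balance col initialC w feasible ⟩
    length (stackC col initialC) + count (push col) w          ≡⟨ cong (λ s → length s + count (push col) w) (stackC-initialC col) ⟩
    count (push col) w                                         ≡⟨ bal ⟩
    count (pop col) w                                          ∎))
    where open ≡-Reasoning

admissible⇒opSeq : ∀ {n w} → Admissible n w → OpSeq n w
admissible⇒opSeq {w = w} (feasible , (d₁ , d₂) , n≡) = record
  { balanced₁ = balanced red d₁
  ; balanced₂ = balanced blue d₂
  ; items     = trans (pushes-count w) n≡
  ; prefix₁   = feasible⇒prefixBounded red initialC w feasible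
  ; prefix₂   = feasible⇒prefixBounded blue initialC w feasible
  }
  where
  balanced : ∀ col → stackC col (runC initialC w) ≡ [] → count (push col) w ≡ count (pop col) w
  balanced col d = begin
    count (push col) w                                         ≡⟨ cong (λ s → length s + count (push col) w) (stackC-initialC col) ⟨
    length (stackC col initialC) + count (push col) w          ≡⟨ stack-balance col initialC w feasible ⟨
    length (stackC col (runC initialC w)) + count (pop col) w  ≡⟨ cong (λ s → length s + count (pop col) w) d ⟩
    count (pop col) w                                          ∎
    where open ≡-Reasoning

-- Eager normal form

data LazyPair : Op → Op → Set where
  lazy₁ : LazyPair I₁ O₂
  lazy₂ : LazyPair I₂ O₁

lazy? : ∀ x y → Dec (LazyPair x y)
lazy? I₁ O₂ = yes lazy₁
lazy? I₂ O₁ = yes lazy₂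
lazy? I₁ I₁ = no λ ()
lazy? I₁ I₂ = no λ ()
lazy? I₁ O₁ = no λ ()
lazy? I₂ I₁ = no λ ()
lazy? I₂ I₂ = no λ ()
lazy? I₂ O₂ = no λ ()
lazy? O₁ _ = no λ ()
lazy? O₂ _ = no λ ()

Eager : List Op → Set
Eager [] = ⊤
Eager (x ∷ []) = ⊤
Eager (x ∷ y ∷ w) = ¬ LazyPair x y × Eager (y ∷ w)

push-pop-notLazy : ∀ c → ¬ LazyPair (push c) (pop c)
push-pop-notLazy red ()
push-pop-notLazy blue ()

push-push-notLazy : ∀ c d → ¬ LazyPair (push c) (push d)
push-push-notLazy red red ()
push-push-notLazy red blue ()
push-push-notLazy blue red ()
push-push-notLazy blue blue ()

pop-notLazy : ∀ c y → ¬ LazyPair (pop c) y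
pop-notLazy red y ()
pop-notLazy blue y ()

eager⇒noLazyFactor : ∀ {x y} → LazyPair x y → ∀ w → Eager w → ∀ u v → w ≢ u ++ x ∷ y ∷ v
eager⇒noLazyFactor l [] e [] v ()
eager⇒noLazyFactor l [] e (_ ∷ _) v ()
eager⇒noLazyFactor l (_ ∷ []) e [] v ()
eager⇒noLazyFactor l (_ ∷ []) e (_ ∷ []) v ()
eager⇒noLazyFactor l (_ ∷ []) e (_ ∷ _ ∷ _) v ()
eager⇒noLazyFactor l (x ∷ y ∷ w) (nl , _) [] v refl = nl l
eager⇒noLazyFactor l (x ∷ y ∷ w) (_ , e) (_ ∷ u) v eq = eager⇒noLazyFactor l (y ∷ w) e u v (∷-injectiveʳ eq)

eager⇒outputsEagerly : ∀ w → Eager w → OutputsEagerly w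
eager⇒outputsEagerly w e = eager⇒noLazyFactor lazy₁ w e , eager⇒noLazyFactor lazy₂ w e

LazyFactor : List Op → Set
LazyFactor w = ∃[ x ] ∃[ y ] (LazyPair x y × ∃[ u ] ∃[ v ] (w ≡ u ++ x ∷ y ∷ v))

eager-or-lazyFactor : ∀ w → Eager w ⊎ LazyFactor w
eager-or-lazyFactor [] = inj₁ tt
eager-or-lazyFactor (x ∷ []) = inj₁ tt
eager-or-lazyFactor (x ∷ y ∷ w) with lazy? x y | eager-or-lazyFactor (y ∷ w)
... | yes l | _ = inj₂ (x , y , l , [] , w , refl)
... | no nl | inj₁ e = inj₁ (nl , e)
... | no _  | inj₂ (a , b , l , u , v , eq) = inj₂ (a , b , l , x ∷ u , v , cong (x ∷_) eq)

stepC-swap : ∀ {x y} → LazyPair x y → ∀ c → stepC (stepC c x) y ≡ stepC (stepC c y) x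
stepC-swap lazy₁ (cfg k s₁ [] o) = refl
stepC-swap lazy₁ (cfg k s₁ (_ ∷ s₂) o) = refl
stepC-swap lazy₂ (cfg k [] s₂ o) = refl
stepC-swap lazy₂ (cfg k (_ ∷ s₁) s₂ o) = refl

runC-swap : ∀ {x y} → LazyPair x y → ∀ c u v → runC c (u ++ x ∷ y ∷ v) ≡ runC c (u ++ y ∷ x ∷ v)
runC-swap l c [] v = cong (λ c′ → runC c′ v) (stepC-swap l c)
runC-swap l c (z ∷ u) v = runC-swap l (stepC c z) u v

feasible-swap : ∀ {x y} → LazyPair x y → ∀ c u v → Feasible c (u ++ x ∷ y ∷ v) → Feasible c (u ++ y ∷ x ∷ v)
feasible-swap lazy₁ c [] v (_ , e , f) = e , tt , subst (λ c′ → Feasible c′ v) (stepC-swap lazy₁ c) f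
feasible-swap lazy₂ c [] v (_ , e , f) = e , tt , subst (λ c′ → Feasible c′ v) (stepC-swap lazy₂ c) f
feasible-swap l c (z ∷ u) v (e , f) = e , feasible-swap l (stepC c z) u v f

sum-map-swap : ∀ (f : Op → ℕ) u x y v → sum (map f (u ++ x ∷ y ∷ v)) ≡ sum (map f (u ++ y ∷ x ∷ v))
sum-map-swap f u x y v = sum-↭ (map⁺ f (++⁺ˡ u (↭-swap x y ↭-refl)))

inversions : List Op → ℕ
inversions [] = 0
inversions (o ∷ w) = pushBit o * pops w + inversions w

inversions-swap : ∀ {x y} → LazyPair x y → ∀ u v → inversions (u ++ x ∷ y ∷ v) ≡ suc (inversions (u ++ y ∷ x ∷ v))
inversions-swap lazy₁ [] v = refl
inversions-swap lazy₂ [] v = refl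
inversions-swap {x} {y} l (z ∷ u) v =
  trans (cong₂ (λ p i → pushBit z * p + i) (sum-map-swap popBit u x y v) (inversions-swap l u v)) (+-suc _ _)

admissible-swap : ∀ {n x y} → LazyPair x y → ∀ u v → Admissible n (u ++ x ∷ y ∷ v) → Admissible n (u ++ y ∷ x ∷ v)
admissible-swap {x = x} {y} l u v (f , d , n≡) =
  feasible-swap l initialC u v f , subst Drained (runC-swap l initialC u v) d , trans (sum-map-swap pushBit u y x v) n≡

output-swap : ∀ {x y} → LazyPair x y → ∀ u v → output (u ++ y ∷ x ∷ v) ≡ output (u ++ x ∷ y ∷ v)
output-swap {x} {y} l u v = begin
  output (u ++ y ∷ x ∷ v)                                     ≡⟨ output-runC (u ++ y ∷ x ∷ v) ⟩
  reverse (Config.outRev (runC initialC (u ++ y ∷ x ∷ v)))  ≡⟨ cong (reverse ∘ Config.outRev) (runC-swap l initialC u v) ⟨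
  reverse (Config.outRev (runC initialC (u ++ x ∷ y ∷ v)))  ≡⟨ output-runC (u ++ x ∷ y ∷ v) ⟨
  output (u ++ x ∷ y ∷ v)                                     ∎
  where open ≡-Reasoning

eagerize : ∀ {n} w → Acc _<_ (inversions w) → Admissible n w →
  ∃[ w′ ] (Admissible n w′ × Eager w′ × output w′ ≡ output w)
eagerize w (acc rs) admissible with eager-or-lazyFactor w
... | inj₁ eager = w , admissible , eager , refl
... | inj₂ (x , y , l , u , v , refl) =
  let (w′ , admissible′ , eager′ , out) = eagerize (u ++ y ∷ x ∷ v) (rs (≤-reflexive (sym (inversions-swap l u v))))
                                                   (admissible-swap l u v admissible)
  in w′ , admissible′ , eager′ , trans out (output-swap l u v)

-- Invariants of the timed machine

stack : Colour → State → List (ℕ × ℕ)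
stack red = State.stack₁
stack blue = State.stack₂

time-step : ∀ s o → State.time (step s o) ≡ suc (State.time s)
time-step s I₁ = refl
time-step s I₂ = refl
time-step (st t k [] s₂ o a) O₁ = refl
time-step (st t k (_ ∷ _) s₂ o a) O₁ = refl
time-step (st t k s₁ [] o a) O₂ = refl
time-step (st t k s₁ (_ ∷ _) o a) O₂ = refl

time-run : ∀ s w → State.time (run s w) ≡ State.time s + length w
time-run s [] = sym (+-identityʳ _)
time-run s (o ∷ w) = trans (time-run (step s o) w) (trans (cong (_+ length w) (time-step s o)) (sym (+-suc _ _)))

arches-step : ∀ s o → State.arches s ⊆ State.arches (step s o)
arches-step s I₁ m = m
arches-step s I₂ m = m
arches-step (st t k [] s₂ o a) O₁ m = m
arches-step (st t k (_ ∷ _) s₂ o a) O₁ m = there m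
arches-step (st t k s₁ [] o a) O₂ m = m
arches-step (st t k s₁ (_ ∷ _) o a) O₂ m = there m

arches-run : ∀ s w → State.arches s ⊆ State.arches (run s w)
arches-run s [] m = m
arches-run s (o ∷ w) m = arches-run (step s o) w (arches-step s o m)

stack-step : ∀ s o c {e} → e ∈ stack c s →
  e ∈ stack c (step s o) ⊎ arch c (proj₂ e) (State.time s) ∈ State.arches (step s o)
stack-step s I₁ red m = inj₁ (there m)
stack-step s I₁ blue m = inj₁ m
stack-step s I₂ red m = inj₁ m
stack-step s I₂ blue m = inj₁ (there m)
stack-step (st t k (_ ∷ _) s₂ o a) O₁ red (here refl) = inj₂ (here refl)
stack-step (st t k (_ ∷ _) s₂ o a) O₁ red (there m) = inj₁ m
stack-step (st t k [] s₂ o a) O₁ blue m = inj₁ m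
stack-step (st t k (_ ∷ _) s₂ o a) O₁ blue m = inj₁ m
stack-step (st t k s₁ (_ ∷ _) o a) O₂ blue (here refl) = inj₂ (here refl)
stack-step (st t k s₁ (_ ∷ _) o a) O₂ blue (there m) = inj₁ m
stack-step (st t k s₁ [] o a) O₂ red m = inj₁ m
stack-step (st t k s₁ (_ ∷ _) o a) O₂ red m = inj₁ m

stack-step⁻ : ∀ s o c {e} → e ∈ stack c (step s o) →
  e ∈ stack c s ⊎ (o ≡ push c × e ≡ (State.next s , State.time s))
stack-step⁻ s I₁ red (here refl) = inj₂ (refl , refl)
stack-step⁻ s I₁ red (there m) = inj₁ m
stack-step⁻ s I₁ blue m = inj₁ m
stack-step⁻ s I₂ blue (here refl) = inj₂ (refl , refl)
stack-step⁻ s I₂ blue (there m) = inj₁ m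
stack-step⁻ s I₂ red m = inj₁ m
stack-step⁻ (st t k [] s₂ o a) O₁ red m = inj₁ m
stack-step⁻ (st t k (_ ∷ _) s₂ o a) O₁ red m = inj₁ (there m)
stack-step⁻ (st t k [] s₂ o a) O₁ blue m = inj₁ m
stack-step⁻ (st t k (_ ∷ _) s₂ o a) O₁ blue m = inj₁ m
stack-step⁻ (st t k s₁ [] o a) O₂ blue m = inj₁ m
stack-step⁻ (st t k s₁ (_ ∷ _) o a) O₂ blue m = inj₁ (there m)
stack-step⁻ (st t k s₁ [] o a) O₂ red m = inj₁ m
stack-step⁻ (st t k s₁ (_ ∷ _) o a) O₂ red m = inj₁ m

arches-step⁻ : ∀ s o {b} → b ∈ State.arches (step s o) →
  b ∈ State.arches s ⊎ ∃[ e ] (e ∈ stack (colour b) s × left b ≡ proj₂ e)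
arches-step⁻ s I₁ m = inj₁ m
arches-step⁻ s I₂ m = inj₁ m
arches-step⁻ (st t k [] s₂ o a) O₁ m = inj₁ m
arches-step⁻ (st t k (e ∷ s₁) s₂ o a) O₁ (here refl) = inj₂ (e , here refl , refl)
arches-step⁻ (st t k (e ∷ s₁) s₂ o a) O₁ (there m) = inj₁ m
arches-step⁻ (st t k s₁ [] o a) O₂ m = inj₁ m
arches-step⁻ (st t k s₁ (e ∷ s₂) o a) O₂ (here refl) = inj₂ (e , here refl , refl)
arches-step⁻ (st t k s₁ (e ∷ s₂) o a) O₂ (there m) = inj₁ m

drained⇒empty : ∀ s → Drained (configOf s) → ∀ c → stack c s ≡ []
drained⇒empty (st t k s₁ s₂ o a) (d₁ , _) red = length≡0⇒≡[] (trans (sym (length-map proj₁ s₁)) (cong length d₁))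
drained⇒empty (st t k s₁ s₂ o a) (_ , d₂) blue = length≡0⇒≡[] (trans (sym (length-map proj₁ s₂)) (cong length d₂))

arch-eventually : ∀ w s c {e} → e ∈ stack c s → Drained (configOf (run s w)) →
  ∃[ r ] (State.time s ≤ r × arch c (proj₂ e) r ∈ State.arches (run s w))
arch-eventually [] s c m d with stack c s | drained⇒empty s d c
arch-eventually [] s c () d | .[] | refl
arch-eventually (o ∷ w) s c m d with stack-step s o c m
... | inj₁ m′ = let (r , t≤r , a) = arch-eventually w (step s o) c m′ d
                in r , ≤-trans (n≤1+n _) (subst (_≤ r) (time-step s o) t≤r) , a
... | inj₂ a = State.time s , ≤-refl , arches-run (step s o) w a

-- Each push is stamped with a fresh time and each pop moves a stamp from a stack to an
-- arch, so the stamps in use never repeat; hence distinct arches have distinct left endpoints.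
stamps : State → List ℕ
stamps s = map left (State.arches s) ++ map proj₂ (State.stack₁ s) ++ map proj₂ (State.stack₂ s)

record Stamped (s : State) : Set where
  field
    below    : All (_< State.time s) (stamps s)
    distinct : Unique (stamps s)

stamps-push : ∀ s c → stamps (step s (push c)) ↭ State.time s ∷ stamps s
stamps-push (st t k s₁ s₂ o a) red = shift t (map left a) _
stamps-push (st t k s₁ s₂ o a) blue =
  ↭-trans (++⁺ˡ (map left a) (shift t (map proj₂ s₁) _)) (shift t (map left a) _)

stamps-pop : ∀ s c {e r} → stack c s ≡ e ∷ r → stamps (step s (pop c)) ↭ stamps s
stamps-pop (st t k ((x , t₀) ∷ s₁) s₂ o a) red refl = ↭-sym (shift t₀ (map left a) _)
stamps-pop (st t k s₁ ((x , t₀) ∷ s₂) o a) blue refl =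
  ↭-sym (↭-trans (++⁺ˡ (map left a) (shift t₀ (map proj₂ s₁) _)) (shift t₀ (map left a) _))

unique-resp-↭ : ∀ {xs ys : List ℕ} → xs ↭ ys → Unique xs → Unique ys
unique-resp-↭ p = Unique-resp-↭ (↭⇒↭ₛ p)

below-suc : ∀ {t xs} → All (_< t) xs → All (_< suc t) xs
below-suc = All.map (λ x<t → <-trans x<t (n<1+n _))

stamped-tick : ∀ t k s₁ s₂ o a → Stamped (st t k s₁ s₂ o a) → Stamped (st (suc t) k s₁ s₂ o a)
stamped-tick t k s₁ s₂ o a S = record { below = below-suc below ; distinct = distinct }
  where open Stamped S

stamped-push : ∀ s c → Stamped s → Stamped (step s (push c))
stamped-push s c S = record
  { below    = All-resp-↭ (↭-sym (stamps-push s c))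
                 (subst (λ t → All (_< t) (State.time s ∷ stamps s)) (sym (time-step s (push c))) (n<1+n _ ∷ below-suc below))
  ; distinct = unique-resp-↭ (↭-sym (stamps-push s c)) (All.map (λ x<t → <⇒≢ x<t ∘ sym) below ∷ distinct)
  }
  where open Stamped S

stamped-pop : ∀ s c {e r} → stack c s ≡ e ∷ r → Stamped s → Stamped (step s (pop c))
stamped-pop s c eq S = record
  { below    = All-resp-↭ (↭-sym (stamps-pop s c eq))
                 (subst (λ t → All (_< t) (stamps s)) (sym (time-step s (pop c))) (below-suc below))
  ; distinct = unique-resp-↭ (↭-sym (stamps-pop s c eq)) distinct
  }
  where open Stamped S

stamped-step : ∀ s o → Stamped s → Stamped (step s o)
stamped-step s I₁ = stamped-push s red
stamped-step s I₂ = stamped-push s blue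
stamped-step (st t k [] s₂ o a) O₁ = stamped-tick t k [] s₂ o a
stamped-step (st t k (_ ∷ _) s₂ o a) O₁ = stamped-pop _ red refl
stamped-step (st t k s₁ [] o a) O₂ = stamped-tick t k s₁ [] o a
stamped-step (st t k s₁ (_ ∷ _) o a) O₂ = stamped-pop _ blue refl

stamped-run : ∀ s w → Stamped s → Stamped (run s w)
stamped-run s [] S = S
stamped-run s (o ∷ w) S = stamped-run (step s o) w (stamped-step s o S)

stamped-initial : Stamped initial
stamped-initial = record { below = [] ; distinct = [] }

stack-stamp< : ∀ s c {e} → Stamped s → e ∈ stack c s → proj₂ e < State.time s
stack-stamp< (st t k s₁ s₂ o a) red S m =
  All.lookup (Stamped.below S) (∈-++⁺ʳ (map left a) (∈-++⁺ˡ (∈-map⁺ proj₂ m)))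
stack-stamp< (st t k s₁ s₂ o a) blue S m =
  All.lookup (Stamped.below S) (∈-++⁺ʳ (map left a) (∈-++⁺ʳ (map proj₂ s₁) (∈-map⁺ proj₂ m)))

unique-map-injective : ∀ {A : Set} (f : A → ℕ) xs ys → Unique (map f xs ++ ys) →
  ∀ {x y} → x ∈ xs → y ∈ xs → f x ≡ f y → x ≡ y
unique-map-injective f (z ∷ xs) ys (z∉ ∷ u) (here refl) (here refl) _ = refl
unique-map-injective f (z ∷ xs) ys (z∉ ∷ u) (here refl) (there m) eq = ⊥-elim (All.lookup z∉ (∈-++⁺ˡ (∈-map⁺ f m)) eq)
unique-map-injective f (z ∷ xs) ys (z∉ ∷ u) (there m) (here refl) eq = ⊥-elim (All.lookup z∉ (∈-++⁺ˡ (∈-map⁺ f m)) (sym eq))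
unique-map-injective f (z ∷ xs) ys (z∉ ∷ u) (there m) (there m′) eq = unique-map-injective f xs ys u m m′ eq

left-injective : ∀ w {b b′} → b ∈ archSystem w → b′ ∈ archSystem w → left b ≡ left b′ → b ≡ b′
left-injective w = unique-map-injective left (archSystem w) _ (Stamped.distinct (stamped-run initial w stamped-initial))

-- Positions in w count from 1, like time points.
PushedAt : List Op → ℕ → Colour → Set
PushedAt w t c = ∃[ u ] ∃[ v ] (w ≡ u ++ push c ∷ v × suc (length u) ≡ t)

pushedAt-snoc : ∀ {h t c} o → PushedAt h t c → PushedAt (h ++ [ o ]) t c
pushedAt-snoc {c = c} o (u , v , refl , l) = u , v ++ [ o ] , ++-assoc u (push c ∷ v) [ o ] , l

record History (h : List Op) (s : State) : Set where
  field
    clock       : State.time s ≡ suc (length h)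
    archPushed  : ∀ {b} → b ∈ State.arches s → PushedAt h (left b) (colour b)
    entryPushed : ∀ c {e} → e ∈ stack c s → PushedAt h (proj₂ e) c

history-step : ∀ {h s} o → History h s → History (h ++ [ o ]) (step s o)
history-step {h} {s} o H = record { clock = clock′ ; archPushed = archPushed′ ; entryPushed = entryPushed′ }
  where
  open History H
  clock′ : State.time (step s o) ≡ suc (length (h ++ [ o ]))
  clock′ = trans (time-step s o) (cong suc (trans clock (trans (+-comm 1 (length h)) (sym (length-++ h)))))
  archPushed′ : ∀ {b} → b ∈ State.arches (step s o) → PushedAt (h ++ [ o ]) (left b) (colour b)
  archPushed′ {b} m with arches-step⁻ s o m
  ... | inj₁ m′ = pushedAt-snoc o (archPushed m′)
  ... | inj₂ (e , me , refl) = pushedAt-snoc o (entryPushed (colour b) me)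
  entryPushed′ : ∀ c {e} → e ∈ stack c (step s o) → PushedAt (h ++ [ o ]) (proj₂ e) c
  entryPushed′ c m with stack-step⁻ s o c m
  ... | inj₁ m′ = pushedAt-snoc o (entryPushed c m′)
  ... | inj₂ (refl , refl) = h , [] , refl , sym clock

history-run : ∀ h s w → History h s → History (h ++ w) (run s w)
history-run h s [] H = subst (λ h′ → History h′ s) (sym (++-identityʳ h)) H
history-run h s (o ∷ w) H =
  subst (λ h′ → History h′ (run s (o ∷ w))) (++-assoc h [ o ] w) (history-run (h ++ [ o ]) (step s o) w (history-step o H))

arch-pushedAt : ∀ w {b} → b ∈ archSystem w → PushedAt w (left b) (colour b)
arch-pushedAt w = History.archPushed (history-run [] initial w record
  { clock = refl ; archPushed = λ () ; entryPushed = λ { red () ; blue () } })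

-- Recolouring arches

flipIf : Bool → Colour → Colour
flipIf false c = c
flipIf true c = opposite c

opposite-≢ : ∀ c → opposite c ≢ c
opposite-≢ red ()
opposite-≢ blue ()

≢⇒opposite : ∀ {a c} → a ≢ c → a ≡ opposite c
≢⇒opposite {red} {red} a≢c = ⊥-elim (a≢c refl)
≢⇒opposite {red} {blue} _ = refl
≢⇒opposite {blue} {red} _ = refl
≢⇒opposite {blue} {blue} a≢c = ⊥-elim (a≢c refl)

flipIf-opposite : ∀ b c → flipIf b (opposite c) ≢ flipIf b c
flipIf-opposite false c = opposite-≢ c
flipIf-opposite true red ()
flipIf-opposite true blue ()

sameColour : Colour → Colour → Bool
sameColour red red = true
sameColour blue blue = true
sameColour _ _ = false

sameColour-refl : ∀ c → sameColour c c ≡ true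
sameColour-refl red = refl
sameColour-refl blue = refl

sameColour⇒≡ : ∀ {a b} → sameColour a b ≡ true → a ≡ b
sameColour⇒≡ {red} {red} _ = refl
sameColour⇒≡ {blue} {blue} _ = refl
sameColour⇒≡ {red} {blue} ()
sameColour⇒≡ {blue} {red} ()

¬sameColour⇒≢ : ∀ {a b} → sameColour a b ≡ false → a ≢ b
¬sameColour⇒≢ {a} differ refl with trans (sym (sameColour-refl a)) differ
... | ()

≢⇒¬sameColour : ∀ {a b} → a ≢ b → sameColour a b ≡ false
≢⇒¬sameColour {red} {red} a≢b = ⊥-elim (a≢b refl)
≢⇒¬sameColour {red} {blue} _ = refl
≢⇒¬sameColour {blue} {red} _ = refl
≢⇒¬sameColour {blue} {blue} a≢b = ⊥-elim (a≢b refl)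

-- A stack entry tagged with the stack it lies on.
Tagged : Set
Tagged = (ℕ × ℕ) × Colour

stampOf : Tagged → ℕ
stampOf ((_ , t) , _) = t

onStack : Colour → List Tagged → List (ℕ × ℕ)
onStack d [] = []
onStack d ((e , c) ∷ L) = if sameColour c d then e ∷ onStack d L else onStack d L

onStack-++ : ∀ d L₁ L₂ → onStack d (L₁ ++ L₂) ≡ onStack d L₁ ++ onStack d L₂
onStack-++ d [] L₂ = refl
onStack-++ d ((e , c) ∷ L₁) L₂ with sameColour c d
... | true = cong (e ∷_) (onStack-++ d L₁ L₂)
... | false = onStack-++ d L₁ L₂

onStack-none : ∀ d L → All (λ x → proj₂ x ≢ d) L → onStack d L ≡ []
onStack-none d [] _ = refl
onStack-none d ((e , c) ∷ L) (c≢d ∷ rest) rewrite ≢⇒¬sameColour c≢d = onStack-none d L rest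

onStack-∈ : ∀ d L {e} → (e , d) ∈ L → e ∈ onStack d L
onStack-∈ d ((e , c) ∷ L) (here refl) rewrite sameColour-refl d = here refl
onStack-∈ d ((e , c) ∷ L) (there m) with sameColour c d
... | true = there (onStack-∈ d L m)
... | false = onStack-∈ d L m

onStack-empty : ∀ L → onStack red L ≡ [] → onStack blue L ≡ [] → L ≡ []
onStack-empty [] _ _ = refl
onStack-empty ((e , red) ∷ L) () _
onStack-empty ((e , blue) ∷ L) _ ()

onStack-top : ∀ c L {p r} → onStack c L ≡ p ∷ r →
  ∃[ L₁ ] ∃[ L₂ ] (L ≡ L₁ ++ (p , c) ∷ L₂ × All (λ x → proj₂ x ≢ c) L₁ × r ≡ onStack c L₂)
onStack-top c ((e , c′) ∷ L) eq with sameColour c′ c in same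
... | true rewrite sameColour⇒≡ same = [] , L , cong (λ e → (e , c) ∷ L) (∷-injectiveˡ eq) , [] , sym (∷-injectiveʳ eq)
... | false =
  let (L₁ , L₂ , split , others , rest) = onStack-top c L eq
  in (e , c′) ∷ L₁ , L₂ , cong ((e , c′) ∷_) split , ¬sameColour⇒≢ same ∷ others , rest

onStack-remove : ∀ c L₁ e L₂ → onStack c L₁ ≡ [] → ∀ d →
  (if sameColour c d then onStack c L₂ else onStack d (L₁ ++ (e , c) ∷ L₂)) ≡ onStack d (L₁ ++ L₂)
onStack-remove c L₁ e L₂ none d with sameColour c d in same
... | true rewrite sym (sameColour⇒≡ same) | onStack-++ c L₁ L₂ | none = refl
... | false rewrite onStack-++ d L₁ ((e , c) ∷ L₂) | onStack-++ d L₁ L₂ | same = refl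

Descending : ℕ → List Tagged → Set
Descending t [] = ⊤
Descending t (x ∷ L) = stampOf x < t × Descending (stampOf x) L

descending-weaken : ∀ {t t′} L → t ≤ t′ → Descending t L → Descending t′ L
descending-weaken [] _ _ = tt
descending-weaken (x ∷ L) t≤t′ (x<t , d) = ≤-trans x<t t≤t′ , d

descending-below : ∀ {t} L → Descending t L → All (λ x → stampOf x < t) L
descending-below [] _ = []
descending-below (x ∷ L) (x<t , d) = x<t ∷ All.map (λ y<x → <-trans y<x x<t) (descending-below L d)

descending-above : ∀ {t} L₁ x L₂ → Descending t (L₁ ++ x ∷ L₂) → All (λ y → stampOf x < stampOf y) L₁
descending-above [] x L₂ _ = []
descending-above (y ∷ L₁) x L₂ (_ , d) =
  All.lookup (descending-below (L₁ ++ x ∷ L₂) d) (∈-++⁺ʳ L₁ (here refl)) ∷ descending-above L₁ x L₂ d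

descending-remove : ∀ {t} L₁ x L₂ → Descending t (L₁ ++ x ∷ L₂) → Descending t (L₁ ++ L₂)
descending-remove [] x L₂ (x<t , d) = descending-weaken L₂ (<⇒≤ x<t) d
descending-remove (y ∷ L₁) x L₂ (y<t , d) = y<t , descending-remove L₁ x L₂ d

stack-push : ∀ s c d →
  stack d (step s (push c)) ≡ (if sameColour c d then (State.next s , State.time s) ∷ stack d s else stack d s)
stack-push s red red = refl
stack-push s red blue = refl
stack-push s blue red = refl
stack-push s blue blue = refl

next-push : ∀ s c → State.next (step s (push c)) ≡ suc (State.next s)
next-push s red = refl
next-push s blue = refl

outRev-push : ∀ s c → State.outRev (step s (push c)) ≡ State.outRev s
outRev-push s red = refl
outRev-push s blue = refl

push-enabled : ∀ cf c → Enabled cf (push c)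
push-enabled cf red = tt
push-enabled cf blue = tt

record Popped (s : State) (c : Colour) (p : ℕ × ℕ) (r : List (ℕ × ℕ)) : Set where
  field
    stacks : ∀ d → stack d (step s (pop c)) ≡ (if sameColour c d then r else stack d s)
    next   : State.next (step s (pop c)) ≡ State.next s
    outRev : State.outRev (step s (pop c)) ≡ proj₁ p ∷ State.outRev s
    arches : State.arches (step s (pop c)) ≡ arch c (proj₂ p) (State.time s) ∷ State.arches s

popped : ∀ s c {p r} → stack c s ≡ p ∷ r → Popped s c p r
popped (st t k _ s₂ o a) red refl =
  record { stacks = λ { red → refl ; blue → refl } ; next = refl ; outRev = refl ; arches = refl }
popped (st t k s₁ _ o a) blue refl =
  record { stacks = λ { red → refl ; blue → refl } ; next = refl ; outRev = refl ; arches = refl }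

pop-enabled : ∀ s c {p r} → stack c s ≡ p ∷ r → Enabled (configOf s) (pop c)
pop-enabled (st t k _ s₂ o a) red refl = λ ()
pop-enabled (st t k s₁ _ o a) blue refl = λ ()

enabled⇒nonempty : ∀ s c → Enabled (configOf s) (pop c) → ∃[ p ] ∃[ r ] (stack c s ≡ p ∷ r)
enabled⇒nonempty (st t k [] s₂ o a) red e = ⊥-elim (e refl)
enabled⇒nonempty (st t k (p ∷ r) s₂ o a) red e = p , r , refl
enabled⇒nonempty (st t k s₁ [] o a) blue e = ⊥-elim (e refl)
enabled⇒nonempty (st t k s₁ (p ∷ r) o a) blue e = p , r , refl

empty⇒drained : ∀ s → (∀ c → stack c s ≡ []) → Drained (configOf s)
empty⇒drained (st t k s₁ s₂ o a) e = cong (map proj₁) (e red) , cong (map proj₁) (e blue)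

feasible-step : ∀ s o {w} → Feasible (configOf s) (o ∷ w) → Feasible (configOf (step s o)) w
feasible-step s o {w} (_ , f) = subst (λ c → Feasible c w) (sym (configOf-step s o)) f

feasible-∷ : ∀ s o {w} → Enabled (configOf s) o → Feasible (configOf (step s o)) w → Feasible (configOf s) (o ∷ w)
feasible-∷ s o {w} e f = e , subst (λ c → Feasible c w) (configOf-step s o) f

-- L is the merged contents of both stacks, from the top down.
MergedStack : State → List Tagged → Set
MergedStack s L = ∀ d → stack d s ≡ onStack d L

merged-push : ∀ s c L → MergedStack s L → MergedStack (step s (push c)) (((State.next s , State.time s) , c) ∷ L)
merged-push s c L merged d =
  trans (stack-push s c d) (cong (λ z → if sameColour c d then _ ∷ z else z) (merged d))

merged-pop : ∀ {s c p} L₁ L₂ → Popped s c p (onStack c L₂) → MergedStack s (L₁ ++ (p , c) ∷ L₂) →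
  onStack c L₁ ≡ [] → MergedStack (step s (pop c)) (L₁ ++ L₂)
merged-pop {c = c} {p} L₁ L₂ popped merged none d =
  trans (Popped.stacks popped d)
        (trans (cong (λ z → if sameColour c d then onStack c L₂ else z) (merged d)) (onStack-remove c L₁ p L₂ none d))

-- Recolouring the arches whose left endpoint t has P t ≡ true.
module Recolouring (P : ℕ → Bool) where

  recolour : Tagged → Tagged
  recolour (e , c) = e , flipIf (P (proj₂ e)) c

  popFor : Colour → List (ℕ × ℕ) → Op
  popFor c [] = pop c
  popFor c (e ∷ _) = pop (flipIf (P (proj₂ e)) c)

  recolourOp : State → Op → Op
  recolourOp s I₁ = push (flipIf (P (State.time s)) red)
  recolourOp s I₂ = push (flipIf (P (State.time s)) blue)
  recolourOp s O₁ = popFor red (State.stack₁ s)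
  recolourOp s O₂ = popFor blue (State.stack₂ s)

  recolourW : State → List Op → List Op
  recolourW s [] = []
  recolourW s (o ∷ w) = recolourOp s o ∷ recolourW (step s o) w

  record Simulates (s s′ : State) (L : List Tagged) : Set where
    field
      original   : MergedStack s L
      recoloured : MergedStack s′ (map recolour L)
      sameTime   : State.time s ≡ State.time s′
      sameNext   : State.next s ≡ State.next s′
      sameOut    : State.outRev s ≡ State.outRev s′
      ordered    : Descending (State.time s) L

  push-simulates : ∀ c s s′ L → Simulates s s′ L →
    Simulates (step s (push c)) (step s′ (push (flipIf (P (State.time s)) c))) (((State.next s , State.time s) , c) ∷ L)
  push-simulates c s s′ L sim = record
    { original   = merged-push s c L original
    ; recoloured = subst (λ e → MergedStack (step s′ (push c′)) ((e , c′) ∷ map recolour L))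
                         (sym (cong₂ _,_ sameNext sameTime)) (merged-push s′ c′ (map recolour L) recoloured)
    ; sameTime   = trans (time-step s (push c)) (trans (cong suc sameTime) (sym (time-step s′ (push c′))))
    ; sameNext   = trans (next-push s c) (trans (cong suc sameNext) (sym (next-push s′ c′)))
    ; sameOut    = trans (outRev-push s c) (trans sameOut (sym (outRev-push s′ c′)))
    ; ordered    = subst (λ t → Descending t (((State.next s , State.time s) , c) ∷ L)) (sym (time-step s (push c)))
                         (≤-refl , ordered)
    }
    where
    open Simulates sim
    c′ = flipIf (P (State.time s)) c

  CoRecoloured : Colour → State → ℕ × ℕ → Set
  CoRecoloured c s p = ∀ {q} → q ∈ stack (opposite c) s → proj₂ p < proj₂ q → proj₂ q < State.time s →
    P (proj₂ p) ≡ P (proj₂ q)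

  recolour-keepsApart : ∀ c s L₁ p L₂ → MergedStack s (L₁ ++ (p , c) ∷ L₂) →
    Descending (State.time s) (L₁ ++ (p , c) ∷ L₂) → All (λ x → proj₂ x ≢ c) L₁ → CoRecoloured c s p →
    All (λ x → proj₂ x ≢ flipIf (P (proj₂ p)) c) (map recolour L₁)
  recolour-keepsApart c s L₁ p L₂ merged ordered others co = All.map⁺ (All.tabulate apart)
    where
    apart : ∀ {x} → x ∈ L₁ → flipIf (P (proj₂ (proj₁ x))) (proj₂ x) ≢ flipIf (P (proj₂ p)) c
    apart {q , cq} x∈ with ≢⇒opposite (All.lookup others x∈)
    ... | refl =
      subst (λ b → flipIf b (opposite c) ≢ flipIf (P (proj₂ p)) c) (co q∈ p<q q<t) (flipIf-opposite (P (proj₂ p)) c)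
      where
      q∈ : q ∈ stack (opposite c) s
      q∈ = subst (q ∈_) (sym (merged (opposite c))) (onStack-∈ (opposite c) _ (∈-++⁺ˡ x∈))
      p<q : proj₂ p < proj₂ q
      p<q = All.lookup (descending-above L₁ (p , c) L₂ ordered) x∈
      q<t : proj₂ q < State.time s
      q<t = All.lookup (descending-below (L₁ ++ (p , c) ∷ L₂) ordered) (∈-++⁺ˡ x∈)

  pop-simulates : ∀ c s s′ L {p r} → Simulates s s′ L → stack c s ≡ p ∷ r → CoRecoloured c s p →
    Enabled (configOf s′) (pop (flipIf (P (proj₂ p)) c)) ×
    ∃[ L′ ] Simulates (step s (pop c)) (step s′ (pop (flipIf (P (proj₂ p)) c))) L′
  pop-simulates c s s′ L {p} sim eq co with onStack-top c L (trans (sym (Simulates.original sim c)) eq)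
  ... | L₁ , L₂ , refl , others , refl = pop-enabled s′ c′ top′ , L₁ ++ L₂ , record
    { original   = merged-pop L₁ L₂ popped₀ original (onStack-none c L₁ others)
    ; recoloured = subst (MergedStack (step s′ (pop c′))) (sym (map-++ recolour L₁ L₂))
                         (merged-pop (map recolour L₁) (map recolour L₂) popped′ recoloured′ none′)
    ; sameTime   = trans (time-step s (pop c)) (trans (cong suc sameTime) (sym (time-step s′ (pop c′))))
    ; sameNext   = trans (Popped.next popped₀) (trans sameNext (sym (Popped.next popped′)))
    ; sameOut    = trans (Popped.outRev popped₀) (trans (cong (proj₁ p ∷_) sameOut) (sym (Popped.outRev popped′)))
    ; ordered    = subst (λ t → Descending t (L₁ ++ L₂)) (sym (time-step s (pop c)))
                         (descending-weaken (L₁ ++ L₂) (n≤1+n _) (descending-remove L₁ (p , c) L₂ ordered))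
    }
    where
    open Simulates sim
    c′ = flipIf (P (proj₂ p)) c
    popped₀ = popped s c eq
    recoloured′ : MergedStack s′ (map recolour L₁ ++ (p , c′) ∷ map recolour L₂)
    recoloured′ = subst (MergedStack s′) (map-++ recolour L₁ ((p , c) ∷ L₂)) recoloured
    none′ : onStack c′ (map recolour L₁) ≡ []
    none′ = onStack-none c′ (map recolour L₁) (recolour-keepsApart c s L₁ p L₂ original ordered others co)
    top′ : stack c′ s′ ≡ p ∷ onStack c′ (map recolour L₂)
    top′ = begin
      stack c′ s′                                                   ≡⟨ recoloured′ c′ ⟩
      onStack c′ (map recolour L₁ ++ (p , c′) ∷ map recolour L₂)    ≡⟨ onStack-++ c′ (map recolour L₁) _ ⟩
      onStack c′ (map recolour L₁) ++ onStack c′ above              ≡⟨ cong (_++ onStack c′ above) none′ ⟩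
      onStack c′ above                                              ≡⟨ cong (if_then p ∷ onStack c′ (map recolour L₂) else onStack c′ (map recolour L₂)) (sameColour-refl c′) ⟩
      p ∷ onStack c′ (map recolour L₂)                              ∎
      where
      open ≡-Reasoning
      above = (p , c′) ∷ map recolour L₂
    popped′ = popped s′ c′ top′

  Closed : List Arch → Set
  Closed As = ∀ {a b} → a ∈ As → b ∈ As → Cross a b → P (left a) ≡ P (left b)

  -- The arch closed by popping p, and that of an entry q above p on the other stack, cross.
  co-recoloured : ∀ w s c {p r} → stack c s ≡ p ∷ r → Drained (configOf (run (step s (pop c)) w)) →
    Closed (State.arches (run (step s (pop c)) w)) → CoRecoloured c s p
  co-recoloured w s c {p} {r} eq drained closed {q} q∈ p<q q<t =
    closed p-arch∈ q-arch∈ (opposite-≢ c ∘ sym , inj₁ (p<q , q<t , subst (_≤ later) (time-step s (pop c)) t<r))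
    where
    popped₀ = popped s c eq
    q∈′ : q ∈ stack (opposite c) (step s (pop c))
    q∈′ = subst (q ∈_) (sym (trans (Popped.stacks popped₀ (opposite c))
                                   (cong (if_then r else stack (opposite c) s) (≢⇒¬sameColour (opposite-≢ c ∘ sym))))) q∈
    eventually = arch-eventually w (step s (pop c)) (opposite c) q∈′ drained
    later = proj₁ eventually
    t<r = proj₁ (proj₂ eventually)
    q-arch∈ = proj₂ (proj₂ eventually)
    p-arch∈ = arches-run (step s (pop c)) w
                (subst (arch c (proj₂ p) (State.time s) ∈_) (sym (Popped.arches popped₀)) (here refl))

  Reproduces : State → List Op → State → List Op → Set
  Reproduces s′ w′ s w = Feasible (configOf s′) w′ × Drained (configOf (run s′ w′))
                       × State.outRev (run s′ w′) ≡ State.outRev (run s w)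

  reproduces-∷ : ∀ {s s′ o o′ w w′} → Enabled (configOf s′) o′ → Reproduces (step s′ o′) w′ (step s o) w →
    Reproduces s′ (o′ ∷ w′) s (o ∷ w)
  reproduces-∷ {s′ = s′} {o′ = o′} e (f , d , out) = feasible-∷ s′ o′ e f , d , out

  recolourOp-push : ∀ s c → recolourOp s (push c) ≡ push (flipIf (P (State.time s)) c)
  recolourOp-push s red = refl
  recolourOp-push s blue = refl

  recolourOp-pop : ∀ s c → recolourOp s (pop c) ≡ popFor c (stack c s)
  recolourOp-pop s red = refl
  recolourOp-pop s blue = refl

  simulate : ∀ w s s′ L → Feasible (configOf s) w → Drained (configOf (run s w)) → Closed (State.arches (run s w)) →
    Simulates s s′ L → Reproduces s′ (recolourW s w) s w
  simulate [] s s′ L _ drained _ sim = tt , empty⇒drained s′ empty′ , sym sameOut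
    where
    open Simulates sim
    L≡[] : L ≡ []
    L≡[] = onStack-empty L (trans (sym (original red)) (drained⇒empty s drained red))
                           (trans (sym (original blue)) (drained⇒empty s drained blue))
    empty′ : ∀ d → stack d s′ ≡ []
    empty′ d = trans (recoloured d) (cong (onStack d ∘ map recolour) L≡[])
  simulate (o ∷ w) s s′ L f drained closed sim with kind o
  ... | pushing c =
    subst (λ o′ → Reproduces s′ (o′ ∷ recolourW (step s (push c)) w) s (push c ∷ w)) (sym (recolourOp-push s c))
      (reproduces-∷ {s} {o = push c} {w = w} (push-enabled _ _)
        (simulate w _ _ _ (feasible-step s (push c) f) drained closed (push-simulates c s s′ L sim)))
  ... | popping c with enabled⇒nonempty s c (proj₁ f)
  ...   | p , r , eq with pop-simulates c s s′ L sim eq (co-recoloured w s c eq drained closed)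
  ...     | enabled′ , L′ , sim′ =
    subst (λ o′ → Reproduces s′ (o′ ∷ recolourW (step s (pop c)) w) s (pop c ∷ w))
      (sym (trans (recolourOp-pop s c) (cong (popFor c) eq)))
      (reproduces-∷ {s} {o = pop c} {w = w} enabled′ (simulate w _ _ L′ (feasible-step s (pop c) f) drained closed sim′))

  recolourW-++ : ∀ s u v → recolourW s (u ++ v) ≡ recolourW s u ++ recolourW (run s u) v
  recolourW-++ s [] v = refl
  recolourW-++ s (o ∷ u) v = cong (recolourOp s o ∷_) (recolourW-++ (step s o) u v)

  length-recolourW : ∀ s w → length (recolourW s w) ≡ length w
  length-recolourW s [] = refl
  length-recolourW s (o ∷ w) = cong suc (length-recolourW (step s o) w)

  popFor-pop : ∀ c l → ∃[ d ] (popFor c l ≡ pop d)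
  popFor-pop c [] = c , refl
  popFor-pop c (e ∷ _) = _ , refl

  pushBit-recolourOp : ∀ s o → pushBit (recolourOp s o) ≡ pushBit o
  pushBit-recolourOp s o with kind o
  ... | pushing c rewrite recolourOp-push s c = trans (pushBit-push _) (sym (pushBit-push c))
  ... | popping c rewrite recolourOp-pop s c with popFor-pop c (stack c s)
  ...   | d , eq rewrite eq = trans (pushBit-pop d) (sym (pushBit-pop c))

  pushes-recolourW : ∀ s w → pushes (recolourW s w) ≡ pushes w
  pushes-recolourW s [] = refl
  pushes-recolourW s (o ∷ w) = cong₂ _+_ (pushBit-recolourOp s o) (pushes-recolourW (step s o) w)

  -- A push and an immediately following pop of the same stack pop the pushed entry,
  -- so they are recoloured alike.
  recolour-notLazy : ∀ s x y → ¬ LazyPair x y → ¬ LazyPair (recolourOp s x) (recolourOp (step s x) y)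
  recolour-notLazy s I₁ O₁ _ = push-pop-notLazy (flipIf (P (State.time s)) red)
  recolour-notLazy s I₂ O₂ _ = push-pop-notLazy (flipIf (P (State.time s)) blue)
  recolour-notLazy s I₁ I₁ _ = push-push-notLazy _ _
  recolour-notLazy s I₁ I₂ _ = push-push-notLazy _ _
  recolour-notLazy s I₂ I₁ _ = push-push-notLazy _ _
  recolour-notLazy s I₂ I₂ _ = push-push-notLazy _ _
  recolour-notLazy s I₁ O₂ notLazy = ⊥-elim (notLazy lazy₁)
  recolour-notLazy s I₂ O₁ notLazy = ⊥-elim (notLazy lazy₂)
  recolour-notLazy s O₁ y _ with popFor-pop red (State.stack₁ s)
  ... | d , eq rewrite eq = pop-notLazy d _
  recolour-notLazy s O₂ y _ with popFor-pop blue (State.stack₂ s)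
  ... | d , eq rewrite eq = pop-notLazy d _

  eager-recolourW : ∀ s w → Eager w → Eager (recolourW s w)
  eager-recolourW s [] _ = tt
  eager-recolourW s (x ∷ []) _ = tt
  eager-recolourW s (x ∷ y ∷ w) (notLazy , eager) =
    recolour-notLazy s x y notLazy , eager-recolourW (step s x) (y ∷ w) eager

  recolourOp-id : ∀ s o → Stamped s → (∀ t → t ≤ State.time s → P t ≡ false) → recolourOp s o ≡ o
  recolourOp-id s o stamped unchanged with kind o
  ... | pushing c rewrite recolourOp-push s c | unchanged (State.time s) ≤-refl = refl
  ... | popping c rewrite recolourOp-pop s c with stack c s in eq
  ...   | [] = refl
  ...   | (x , t) ∷ _ rewrite unchanged t (<⇒≤ (stack-stamp< s c stamped (subst ((x , t) ∈_) (sym eq) (here refl)))) = refl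

  recolourW-id : ∀ s u → Stamped s → (∀ t → t < State.time s + length u → P t ≡ false) → recolourW s u ≡ u
  recolourW-id s [] _ _ = refl
  recolourW-id s (o ∷ u) stamped unchanged =
    cong₂ _∷_ (recolourOp-id s o stamped (λ t t≤ → unchanged t (≤-<-trans t≤ now<end)))
              (recolourW-id (step s o) u (stamped-step s o stamped) (λ t t< → unchanged t (<-≤-trans t< later≤end)))
    where
    now<end : State.time s < State.time s + length (o ∷ u)
    now<end = m<m+n (State.time s) (s≤s z≤n)
    later≤end : State.time (step s o) + length u ≤ State.time s + length (o ∷ u)
    later≤end = ≤-reflexive (trans (cong (_+ length u) (time-step s o)) (sym (+-suc _ _)))

-- Components of the crossing graph

_≟ᶜ_ : (a b : Colour) → Dec (a ≡ b)
red ≟ᶜ red = yes refl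
red ≟ᶜ blue = no λ ()
blue ≟ᶜ red = no λ ()
blue ≟ᶜ blue = yes refl

cross? : ∀ a b → Dec (Cross a b)
cross? a b = ¬? (colour a ≟ᶜ colour b) ×-dec
  ((left a <? left b ×-dec left b <? right a ×-dec right a <? right b) ⊎-dec
   (left b <? left a ×-dec left a <? right b ×-dec right b <? right a))

cross-sym : ∀ {a b} → Cross a b → Cross b a
cross-sym (a≢b , inj₁ i) = a≢b ∘ sym , inj₂ i
cross-sym (a≢b , inj₂ i) = a≢b ∘ sym , inj₁ i

connected-snoc : ∀ {As a b c} → Connected As a b → c ∈ As → Cross b c → Connected As a c
connected-snoc here c∈ b×c = link c∈ b×c here
connected-snoc (link x∈ a×x x⇝b) c∈ b×c = link x∈ a×x (connected-snoc x⇝b c∈ b×c)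

record Component (As : List Arch) (a : Arch) : Set where
  field
    members   : List Arch
    ⊆arches   : members ⊆ As
    connected : ∀ {x} → x ∈ members → Connected As a x
    closed    : ∀ {x y} → x ∈ members → y ∈ As → Cross x y → y ∈ members
    contains  : a ∈ members

module Exploration (As : List Arch) (a : Arch) where

  record Explored (S U : List Arch) : Set where
    field
      visited⊆   : S ⊆ As
      unvisited⊆ : U ⊆ As
      reached    : ∀ {x} → x ∈ S → Connected As a x
      covers     : ∀ {x} → x ∈ As → x ∈ S ⊎ x ∈ U
      start      : a ∈ S

  CrossedFrom : List Arch → Arch → Set
  CrossedFrom S y = Any (λ x → Cross x y) S

  crossedFrom? : ∀ S y → Dec (CrossedFrom S y)
  crossedFrom? S y = any? (λ x → cross? x y) S

  expand : ∀ {S U} → Explored S U →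
    Explored (filter (crossedFrom? S) U ++ S) (filter (¬? ∘ crossedFrom? S) U)
  expand {S} {U} explored = record
    { visited⊆   = λ x∈ → [ unvisited⊆ ∘ proj₁ ∘ ∈-filter⁻ (crossedFrom? S) , visited⊆ ]′ (∈-++⁻ new x∈)
    ; unvisited⊆ = unvisited⊆ ∘ proj₁ ∘ ∈-filter⁻ (¬? ∘ crossedFrom? S)
    ; reached    = λ x∈ → [ reachedNew , reached ]′ (∈-++⁻ new x∈)
    ; covers     = λ x∈ → [ inj₁ ∘ ∈-++⁺ʳ new , sortUnvisited ]′ (covers x∈)
    ; start      = ∈-++⁺ʳ new start
    }
    where
    open Explored explored
    new = filter (crossedFrom? S) U
    reachedNew : ∀ {y} → y ∈ new → Connected As a y
    reachedNew y∈ with ∈-filter⁻ (crossedFrom? S) y∈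
    ... | y∈U , crossed with find crossed
    ...   | x , x∈S , x×y = connected-snoc (reached x∈S) (unvisited⊆ y∈U) x×y
    sortUnvisited : ∀ {y} → y ∈ U → y ∈ new ++ S ⊎ y ∈ filter (¬? ∘ crossedFrom? S) U
    sortUnvisited {y} y∈U with crossedFrom? S y
    ... | yes crossed = inj₁ (∈-++⁺ˡ (∈-filter⁺ (crossedFrom? S) y∈U crossed))
    ... | no uncrossed = inj₂ (∈-filter⁺ (¬? ∘ crossedFrom? S) y∈U uncrossed)

  explore : ∀ S U → Acc _<_ (length U) → Explored S U → Component As a
  explore S U (acc rs) explored with any? (crossedFrom? S) U
  ... | yes some = explore _ _ (rs (filter-notAll (¬? ∘ crossedFrom? S) U (Any.map (λ c ¬c → ¬c c) some))) (expand explored)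
  ... | no none = record
    { members   = S
    ; ⊆arches   = visited⊆
    ; connected = reached
    ; closed    = λ x∈ y∈ x×y → [ id , (λ y∈U → ⊥-elim (none (lose y∈U (lose x∈ x×y)))) ]′ (covers y∈)
    ; contains  = start
    }
    where open Explored explored

component : ∀ As a → a ∈ As → Component As a
component As a a∈ = Exploration.explore As a [ a ] As (<-wellFounded _) record
  { visited⊆   = λ { (here refl) → a∈ }
  ; unvisited⊆ = id
  ; reached    = λ { (here refl) → here }
  ; covers     = inj₂
  ; start      = here refl
  }

-- Standard normal form

digit : Op → ℕ
digit I₁ = 0
digit I₂ = 1
digit O₁ = 2
digit O₂ = 3

-- The word read as a base-4 numeral; among words of equal length this is the lexicographic order.
numeral : List Op → ℕ
numeral [] = 0
numeral (o ∷ w) = digit o * 4 ^ length w + numeral w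

digit≤3 : ∀ o → digit o ≤ 3
digit≤3 I₁ = z≤n
digit≤3 I₂ = s≤s z≤n
digit≤3 O₁ = s≤s (s≤s z≤n)
digit≤3 O₂ = ≤-refl

numeral< : ∀ w → numeral w < 4 ^ length w
numeral< [] = s≤s z≤n
numeral< (o ∷ w) = begin-strict
  digit o * 4 ^ length w + numeral w   <⟨ +-monoʳ-< (digit o * 4 ^ length w) (numeral< w) ⟩
  digit o * 4 ^ length w + 4 ^ length w ≡⟨ +-comm (digit o * 4 ^ length w) _ ⟩
  suc (digit o) * 4 ^ length w          ≤⟨ *-monoˡ-≤ (4 ^ length w) (s≤s (digit≤3 o)) ⟩
  4 * 4 ^ length w                      ∎
  where open ≤-Reasoning

numeral-I₁<I₂ : ∀ u v v′ → length v′ ≡ length v → numeral (u ++ I₁ ∷ v′) < numeral (u ++ I₂ ∷ v)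
numeral-I₁<I₂ [] v v′ same = begin-strict
  numeral v′                   <⟨ numeral< v′ ⟩
  4 ^ length v′                ≡⟨ cong (4 ^_) same ⟩
  4 ^ length v                 ≡⟨ *-identityˡ _ ⟨
  1 * 4 ^ length v             ≤⟨ m≤m+n _ _ ⟩
  1 * 4 ^ length v + numeral v ∎
  where open ≤-Reasoning
numeral-I₁<I₂ (o ∷ u) v v′ same =
  subst (λ l → digit o * 4 ^ l + numeral (u ++ I₁ ∷ v′) < digit o * 4 ^ length (u ++ I₂ ∷ v) + numeral (u ++ I₂ ∷ v))
        (sym sameLength) (+-monoʳ-< (digit o * 4 ^ length (u ++ I₂ ∷ v)) (numeral-I₁<I₂ u v v′ same))
  where
  sameLength : length (u ++ I₁ ∷ v′) ≡ length (u ++ I₂ ∷ v)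
  sameLength = trans (length-++ u) (trans (cong (λ l → length u + suc l) same) (sym (length-++ u)))

LeftmostInComponent : List Arch → Arch → Set
LeftmostInComponent As a = ∀ b → b ∈ As → Connected As a b → left a ≤ left b

record Offending (As : List Arch) : Set where
  field
    a        : Arch
    a∈       : a ∈ As
    isBlue   : colour a ≡ blue
    comp     : Component As a
    leftmost : ∀ {b} → b ∈ Component.members comp → left a ≤ left b

classify : ∀ {As a} → a ∈ As → Component As a → (LeftmostInComponent As a → colour a ≡ red) ⊎ Offending As
classify {As} {a} a∈ C with All.all? (λ b → left a ≤? left b) (Component.members C)
... | no notLeftmost = inj₁ λ leftmost → ⊥-elim (notLeftmost (All.tabulate λ b∈ →
        leftmost _ (Component.⊆arches C b∈) (Component.connected C b∈)))
... | yes leftmost with colour a in col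
...   | red = inj₁ λ _ → refl
...   | blue = inj₂ record { a = a ; a∈ = a∈ ; isBlue = col ; comp = C ; leftmost = All.lookup leftmost }

standard-or-offending : ∀ As L → L ⊆ As →
  (∀ a → a ∈ L → LeftmostInComponent As a → colour a ≡ red) ⊎ Offending As
standard-or-offending As [] _ = inj₁ λ _ ()
standard-or-offending As (a ∷ L) L⊆
  with classify (L⊆ (here refl)) (component As a (L⊆ (here refl))) | standard-or-offending As L (L⊆ ∘ there)
... | inj₂ offending | _ = inj₂ offending
... | inj₁ _ | inj₂ offending = inj₂ offending
... | inj₁ redIfLeftmost | inj₁ rest = inj₁ λ { _ (here refl) → redIfLeftmost ; b (there b∈) → rest b b∈ }

standard? : ∀ w → Standard w ⊎ Offending (archSystem w)
standard? w = standard-or-offending (archSystem w) (archSystem w) id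

module InComponent (w : List Op) (offending : Offending (archSystem w)) where
  open Offending offending
  open Component comp

  inComponent : ℕ → Bool
  inComponent t = does (any? (λ b → left b ≟ t) members)

  inComponent-member : ∀ {b} → b ∈ members → inComponent (left b) ≡ true
  inComponent-member b∈ = dec-true (any? (λ b → left b ≟ _) members) (lose b∈ refl)

  inComponent⇒member : ∀ {t} → inComponent t ≡ true → ∃[ b ] (b ∈ members × left b ≡ t)
  inComponent⇒member {t} e with any? (λ b → left b ≟ t) members
  ... | yes found = find found
  ... | no _ = contradiction e λ ()

  inComponent-closed : Recolouring.Closed inComponent (archSystem w)
  inComponent-closed x∈ y∈ x×y = ⇔→≡ {z = true} (mk⇔ (spread x∈ y∈ x×y) (spread y∈ x∈ (cross-sym x×y)))
    where
    spread : ∀ {x y} → x ∈ archSystem w → y ∈ archSystem w → Cross x y →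
      inComponent (left x) ≡ true → inComponent (left y) ≡ true
    spread x∈ y∈ x×y e with inComponent⇒member e
    ... | b , b∈ , same with left-injective w (⊆arches b∈) x∈ same
    ...   | refl = inComponent-member (closed b∈ y∈ x×y)

  inComponent-leftmost : ∀ {t} → inComponent t ≡ true → left a ≤ t
  inComponent-leftmost e with inComponent⇒member e
  ... | b , b∈ , refl = leftmost b∈

  open Recolouring inComponent public

  -- Arch a is pushed at time left a; everything before is untouched and that push turns red.
  recolourW-decreases : numeral (recolourW initial w) < numeral w
  recolourW-decreases with arch-pushedAt w a∈
  ... | u , v , w≡ , len = begin-strict
    numeral (recolourW initial w)                                              ≡⟨ cong (numeral ∘ recolourW initial) w≡′ ⟩
    numeral (recolourW initial (u ++ I₂ ∷ v))                                  ≡⟨ cong numeral (recolourW-++ initial u (I₂ ∷ v)) ⟩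
    numeral (recolourW initial u ++ recolourOp (run initial u) I₂ ∷ rest)      ≡⟨ cong₂ (λ x y → numeral (x ++ y ∷ rest)) prefixKept pushTurnsRed ⟩
    numeral (u ++ I₁ ∷ rest)                                                   <⟨ numeral-I₁<I₂ u v rest (length-recolourW _ v) ⟩
    numeral (u ++ I₂ ∷ v)                                                      ≡⟨ cong numeral w≡′ ⟨
    numeral w                                                                  ∎
    where
    open ≤-Reasoning
    rest = recolourW (step (run initial u) I₂) v
    w≡′ : w ≡ u ++ I₂ ∷ v
    w≡′ = trans w≡ (cong (λ c → u ++ push c ∷ v) isBlue)
    prefixKept : recolourW initial u ≡ u
    prefixKept = recolourW-id initial u stamped-initial unchanged
      where
      unchanged : ∀ t → t < suc (length u) → inComponent t ≡ false
      unchanged t t< with inComponent t in e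
      ... | false = refl
      ... | true = ⊥-elim (<-irrefl refl (<-≤-trans t< (≤-trans (≤-reflexive len) (inComponent-leftmost e))))
    pushTurnsRed : recolourOp (run initial u) I₂ ≡ I₁
    pushTurnsRed = trans (cong (λ t → push (flipIf (inComponent t) blue)) (trans (time-run initial u) len))
                         (cong (λ b → push (flipIf b blue)) (inComponent-member contains))

recolour-step : ∀ {n} w → Admissible n w → Eager w → Offending (archSystem w) →
  ∃[ w′ ] (Admissible n w′ × Eager w′ × output w′ ≡ output w × numeral w′ < numeral w)
recolour-step w (feasible , drained , pushes≡) eager offending =
  recolourW initial w ,
  (feasible′ , subst Drained (configOf-run initial (recolourW initial w)) drained′ , trans (pushes-recolourW initial w) pushes≡) ,
  eager-recolourW initial w eager , cong reverse sameOut , recolourW-decreases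
  where
  open InComponent w offending
  start : Simulates initial initial []
  start = record
    { original   = λ { red → refl ; blue → refl }
    ; recoloured = λ { red → refl ; blue → refl }
    ; sameTime   = refl
    ; sameNext   = refl
    ; sameOut    = refl
    ; ordered    = tt
    }
  reproduced : Reproduces initial (recolourW initial w) initial w
  reproduced = simulate w initial initial [] feasible (subst Drained (sym (configOf-run initial w)) drained)
                        inComponent-closed start
  feasible′ = proj₁ reproduced
  drained′ = proj₁ (proj₂ reproduced)
  sameOut = proj₂ (proj₂ reproduced)

standardize : ∀ {n} w → Acc _<_ (numeral w) → Admissible n w → Eager w →
  ∃[ w′ ] (Admissible n w′ × Eager w′ × Standard w′ × output w′ ≡ output w)
standardize w (acc rs) admissible eager with standard? w
... | inj₁ standard = w , admissible , eager , standard , refl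
... | inj₂ offending with recolour-step w admissible eager offending
...   | w′ , admissible′ , eager′ , out′ , smaller with standardize w′ (rs smaller) admissible′ eager′
...     | w″ , admissible″ , eager″ , standard″ , out″ = w″ , admissible″ , eager″ , standard″ , trans out″ out′

lemma2p2 : (n : ℕ) (π : List ℕ) → Achievable n π →
    ∃[ w ] (OpSeq n w × Canonical w × output w ≡ π)
lemma2p2 n π (w , opSeq , refl) =
  let (w₁ , admissible₁ , eager₁ , out₁) = eagerize w (<-wellFounded _) (opSeq⇒admissible opSeq)
      (w₂ , admissible₂ , eager₂ , standard₂ , out₂) = standardize w₁ (<-wellFounded _) admissible₁ eager₁
  in w₂ , admissible⇒opSeq admissible₂ , (standard₂ , eager⇒outputsEagerly w₂ eager₂) , trans out₂ out₁
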